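{- Let $G$ be a torsion-free Abelian group and let $\Pi=(\mathcal{P},\mathcal{L})$ be a finite projective plane. Then $\Pi$ is not pseudomagic over $G$; that is, every function $v:\mathcal{P}\to G$ such that $\sum_{x\in L}v(x)$ is the same for all $L\in\mathcal{L}$ is constant.
   Context: A projective plane $\Pi=(\mathcal{P},\mathcal{L})$ consists of a set of points $\mathcal{P}$ and a set $\mathcal{L}$ of lines (each a subset of $\mathcal{P}$) such that any two distinct points lie on a unique common line, any two distinct lines meet in a unique point, and there exist four points no three of which lie on a common line; it is finite if $\mathcal{P}$ is finite. For an Abelian group $G$ and $v:\mathcal{P}\to G$, write $v(S)=\sum_{x\in S}v(x)$ for $S\subseteq\mathcal{P}$. $v$ is line invariant if $v(L)=v(L')$ for all $L,L'\in\mathcal{L}$; $v$ is pseudomagic if it is line invariant and non-constant. $\Pi$ is pseudomagic over $G$ if a pseudomagic $v:\mathcal{P}\to G$ exists. A group is torsion-free if it has no non-identity elements of finite order. -}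

module Defs where

open import Level using (Level; _⊔_)
open import Data.Nat using (ℕ; zero; suc)
open import Data.Fin using (Fin; zero; suc)
open import Data.Fin.Subset using (Subset; _∈_)
open import Data.Vec using (lookup)
open import Data.Bool using (true; false)
open import Data.Sum using (_⊎_)
open import Data.Product using (Σ; ∃; _×_; _,_)
open import Relation.Nullary using (¬_)
open import Relation.Binary.PropositionalEquality using (_≡_; _≢_)
open import Function.Definitions using (Injective)
open import Algebra.Bundles using (AbelianGroup)

record IsProjectivePlane {n m : ℕ} (line : Fin m → Subset n) : Set where
  field
    two-points : ∀ (p q : Fin n) → p ≢ q →
      Σ (Fin m) λ l → (p ∈ line l) × (q ∈ line l) ×
        (∀ (l' : Fin m) → p ∈ line l' → q ∈ line l' → l' ≡ l)
    two-lines : ∀ (l l' : Fin m) → l ≢ l' →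
      Σ (Fin n) λ p → (p ∈ line l) × (p ∈ line l') ×
        (∀ (p' : Fin n) → p' ∈ line l → p' ∈ line l' → p' ≡ p)
    lines-distinct : Injective _≡_ _≡_ line
    quadrangle : Σ (Fin 4 → Fin n) λ f →
      Injective _≡_ _≡_ f ×
      (∀ (i j k : Fin 4) → i ≢ j → j ≢ k → i ≢ k →
        ¬ (Σ (Fin m) λ l → (f i ∈ line l) × (f j ∈ line l) × (f k ∈ line l)))

module _ {c ℓ : Level} (G : AbelianGroup c ℓ) where
  open AbelianGroup G

  infixr 8 _·_
  _·_ : ℕ → Carrier → Carrier
  zero  · x = ε
  suc k · x = x ∙ k · x

  TorsionFree : Set (c ⊔ ℓ)
  TorsionFree = ∀ (k : ℕ) (x : Carrier) → k · x ≈ ε → k ≡ zero ⊎ x ≈ ε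

  sumFin : ∀ {n : ℕ} → (Fin n → Carrier) → Carrier
  sumFin {zero}  f = ε
  sumFin {suc n} f = f zero ∙ sumFin (λ i → f (suc i))

  sumOver : ∀ {n : ℕ} → Subset n → (Fin n → Carrier) → Carrier
  sumOver S v = sumFin (λ x → restrict (lookup S x) (v x))
    where
      open import Data.Bool using (Bool)
      restrict : Bool → Carrier → Carrier
      restrict true  a = a
      restrict false a = ε

  LineInvariant : ∀ {n m : ℕ} → (Fin m → Subset n) → (Fin n → Carrier) → Set ℓ
  LineInvariant line v = ∀ l l' → sumOver (line l) v ≈ sumOver (line l') v

  Constant : ∀ {n : ℕ} → (Fin n → Carrier) → Set ℓ
  Constant v = ∀ x y → v x ≈ v y

  Pseudomagic : ∀ {n m : ℕ} → (Fin m → Subset n) → (Fin n → Carrier) → Set ℓ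
  Pseudomagic line v = LineInvariant line v × ¬ Constant v

module Submission where

-- Fix a line l with k = |l| points and a point p off l.  The k lines joining
-- p to the points of l form a pencil: each contains p, and every other point
-- y lies on exactly one of them.  Double counting the sum of v over the
-- pencil therefore gives
--      k·c + v(p) = k·v(p) + S          (c = common line sum, S = Σ v),
-- so (k-1)·v(p) = k·c - S does not depend on p.  If l has two points then
-- k - 1 ≥ 1 and torsion-freeness cancels the factor: v is constant on the
-- points off l.  Finally, a quadrangle supplies enough lines with two points
-- to connect any point to a fixed one.

open import Defs
open import Level using (Level)
open import Data.Nat using (ℕ)
open import Data.Fin using (Fin)
open import Data.Fin.Subset using (Subset)
open import Algebra.Bundles using (AbelianGroup)

open import Algebra.Bundles using (CommutativeMonoid)
open import Relation.Binary.Bundles using (Setoid)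
open import Data.Nat using (zero; suc; _≤_; s≤s; z≤n)
open import Data.Nat.Properties using (≤-<-trans)
open import Data.Fin using (zero; suc; _≟_)
open import Data.Fin.Subset using (_∈_; _∉_; ⁅_⁆; ∣_∣; _-_)
open import Data.Fin.Subset.Properties
  using (_∈?_; x∈⁅x⁆; x∈⁅y⁆⇒x≡y; x≢y⇒x∉⁅y⁆; ∣⁅x⁆∣≡1; x∈p⇒∣p-x∣<∣p∣; x∈p∧x≢y⇒x∈p-y)
open import Data.Vec using ([]; _∷_; lookup)
open import Data.Vec.Properties using ([]=⇒lookup; lookup⇒[]=)
open import Data.Bool using (true; false; if_then_else_)
open import Data.Sum using (inj₁; inj₂)
open import Data.Product using (_,_; proj₁; proj₂)
open import Data.Empty using (⊥)
open import Relation.Nullary using (yes; no; contradiction)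
open import Relation.Binary.PropositionalEquality as ≡ using (_≡_; _≢_; ≢-sym)

-- Two distinct members force a subset to have at least two elements:
-- removing x strictly shrinks S, and S - x still contains y.
two-members : ∀ {n} {x y : Fin n} {S : Subset n} → x ∈ S → y ∈ S → x ≢ y → 2 ≤ ∣ S ∣
two-members {x = x} {y} {S} x∈S y∈S x≢y =
  ≤-<-trans (≤-<-trans z≤n (x∈p⇒∣p-x∣<∣p∣ y∈S-x)) (x∈p⇒∣p-x∣<∣p∣ x∈S)
  where
  y∈S-x : y ∈ S - x
  y∈S-x = x∈p∧x≢y⇒x∈p-y y∈S (≢-sym x≢y)

module SubsetSums {c ℓ : Level} (M : CommutativeMonoid c ℓ) where
  open CommutativeMonoid M
  open import Algebra.Properties.CommutativeMonoid.Sum M public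
    using (sum; sum-cong-≋; sum-cong-≗; sum-replicate-zero; ∑-distrib-+; ∑-comm)
  open import Algebra.Properties.CommutativeMonoid.Mult M public
    using (_×_; ×-homo-1)

  sumOn : ∀ {n} → Subset n → (Fin n → Carrier) → Carrier
  sumOn S f = sum (λ x → if lookup S x then f x else ε)

  if-∈ : ∀ {n} {S : Subset n} {x} → x ∈ S → ∀ a → (if lookup S x then a else ε) ≡ a
  if-∈ x∈S a rewrite []=⇒lookup x∈S = ≡.refl

  if-∉ : ∀ {n} {S : Subset n} {x} → x ∉ S → ∀ a → (if lookup S x then a else ε) ≡ ε
  if-∉ {S = S} {x} x∉S a with lookup S x in eq
  ... | true  = contradiction (lookup⇒[]= x S eq) x∉S
  ... | false = ≡.refl

  if-sum : ∀ {n} b (f : Fin n → Carrier) →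
    (if b then sum f else ε) ≈ sum (λ y → if b then f y else ε)
  if-sum true  f = refl
  if-sum {n} false f = sym (sum-replicate-zero n)

  sumOn-cong : ∀ {n} (S : Subset n) {f g : Fin n → Carrier} →
    (∀ {x} → x ∈ S → f x ≈ g x) → sumOn S f ≈ sumOn S g
  sumOn-cong S {f} {g} f≈g = sum-cong-≋ pointwise
    where
    pointwise : ∀ x → (if lookup S x then f x else ε) ≈ (if lookup S x then g x else ε)
    pointwise x with x ∈? S
    ... | yes x∈S = trans (reflexive (if-∈ x∈S (f x))) (trans (f≈g x∈S) (reflexive (≡.sym (if-∈ x∈S (g x)))))
    ... | no  x∉S = reflexive (≡.trans (if-∉ x∉S (f x)) (≡.sym (if-∉ x∉S (g x))))

  sumOn-const : ∀ {n} (S : Subset n) a → sumOn S (λ _ → a) ≈ ∣ S ∣ × a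
  sumOn-const []          a = refl
  sumOn-const (true  ∷ S) a = ∙-congˡ (sumOn-const S a)
  sumOn-const (false ∷ S) a = trans (identityˡ _) (sumOn-const S a)

  sumOn-⁅⁆ : ∀ {n} (p : Fin n) f → sumOn ⁅ p ⁆ f ≈ f p
  sumOn-⁅⁆ p f = begin
    sumOn ⁅ p ⁆ f              ≈⟨ sumOn-cong ⁅ p ⁆ (λ x∈⁅p⁆ → reflexive (≡.cong f (x∈⁅y⁆⇒x≡y p x∈⁅p⁆))) ⟩
    sumOn ⁅ p ⁆ (λ _ → f p)    ≈⟨ sumOn-const ⁅ p ⁆ (f p) ⟩
    ∣ ⁅ p ⁆ ∣ × f p            ≡⟨ ≡.cong (_× f p) (∣⁅x⁆∣≡1 p) ⟩
    1 × f p                    ≈⟨ ×-homo-1 (f p) ⟩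
    f p                        ∎
    where open import Relation.Binary.Reasoning.Setoid setoid

-- L assigns to each x a set L x ("the line px").  Then summing v over all L x
-- (x ∈ l) counts p once per member of l and every other point once.
module Pencil {c ℓ : Level} (M : CommutativeMonoid c ℓ) {n : ℕ}
  (v : Fin n → CommutativeMonoid.Carrier M) (l : Subset n) (p : Fin n)
  (L : Fin n → Subset n)
  (through : ∀ {x} → x ∈ l → p ∈ L x)
  (base : ∀ {y} → y ≢ p → Fin n)
  (base-∈ : ∀ {y} (y≢p : y ≢ p) → base y≢p ∈ l)
  (base-covers : ∀ {y} (y≢p : y ≢ p) → y ∈ L (base y≢p))
  (base-unique : ∀ {x y} (y≢p : y ≢ p) → x ∈ l → y ∈ L x → x ≡ base y≢p)
  where
  open CommutativeMonoid M
  open SubsetSums M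
  open import Relation.Binary.Reasoning.Setoid setoid

  -- The contribution of a single point y to the pencil sum.
  column : Fin n → Carrier
  column y = sumOn l (λ x → if lookup (L x) y then v y else ε)

  -- A point y ≠ p is counted exactly once: only x = base y contributes.
  column-off-p : ∀ {y} → y ≢ p → column y ≈ v y
  column-off-p {y} y≢p = begin
    column y                         ≡⟨ sum-cong-≗ only-base ⟩
    sumOn ⁅ base y≢p ⁆ (λ _ → v y)   ≈⟨ sumOn-⁅⁆ (base y≢p) (λ _ → v y) ⟩
    v y                              ∎
    where
    only-base : ∀ x → (if lookup l x then (if lookup (L x) y then v y else ε) else ε)
                    ≡ (if lookup ⁅ base y≢p ⁆ x then v y else ε)
    only-base x with x ≟ base y≢p
    ... | yes ≡.refl = ≡.trans (if-∈ (base-∈ y≢p) _)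
      (≡.trans (if-∈ (base-covers y≢p) (v y)) (≡.sym (if-∈ (x∈⁅x⁆ x) (v y))))
    ... | no x≢base = ≡.trans off-l-or-L (≡.sym (if-∉ (x≢y⇒x∉⁅y⁆ x≢base) (v y)))
      where
      off-l-or-L : (if lookup l x then (if lookup (L x) y then v y else ε) else ε) ≡ ε
      off-l-or-L with x ∈? l
      ... | no  x∉l = if-∉ x∉l _
      ... | yes x∈l with y ∈? L x
      ...   | yes y∈Lx = contradiction (base-unique y≢p x∈l y∈Lx) x≢base
      ...   | no  y∉Lx = ≡.trans (if-∈ x∈l _) (if-∉ y∉Lx (v y))

  column-p : column p ≈ ∣ l ∣ × v p
  column-p = trans (sumOn-cong l (λ x∈l → reflexive (if-∈ (through x∈l) (v p))))
                   (sumOn-const l (v p))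

  -- Both cases at once, with p's value added to balance the two sides.
  column-balanced : ∀ y → column y ∙ (if lookup ⁅ p ⁆ y then v y else ε)
                        ≈ (if lookup ⁅ p ⁆ y then ∣ l ∣ × v y else ε) ∙ v y
  column-balanced y with y ≟ p
  ... | yes ≡.refl = begin
    column p ∙ (if lookup ⁅ p ⁆ p then v p else ε)
      ≡⟨ ≡.cong (column p ∙_) (if-∈ (x∈⁅x⁆ p) (v p)) ⟩
    column p ∙ v p
      ≈⟨ ∙-congʳ column-p ⟩
    ∣ l ∣ × v p ∙ v p
      ≡⟨ ≡.cong (_∙ v p) (if-∈ (x∈⁅x⁆ p) (∣ l ∣ × v p)) ⟨
    (if lookup ⁅ p ⁆ p then ∣ l ∣ × v p else ε) ∙ v p ∎
  ... | no y≢p = begin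
    column y ∙ (if lookup ⁅ p ⁆ y then v y else ε)
      ≡⟨ ≡.cong (column y ∙_) (if-∉ (x≢y⇒x∉⁅y⁆ y≢p) (v y)) ⟩
    column y ∙ ε
      ≈⟨ identityʳ _ ⟩
    column y
      ≈⟨ column-off-p y≢p ⟩
    v y
      ≈⟨ identityˡ _ ⟨
    ε ∙ v y
      ≡⟨ ≡.cong (_∙ v y) (if-∉ (x≢y⇒x∉⁅y⁆ y≢p) (∣ l ∣ × v y)) ⟨
    (if lookup ⁅ p ⁆ y then ∣ l ∣ × v y else ε) ∙ v y ∎

  pencil-sum : sumOn l (λ x → sumOn (L x) v) ∙ v p ≈ ∣ l ∣ × v p ∙ sum v
  pencil-sum = begin
    sumOn l (λ x → sumOn (L x) v) ∙ v p
      ≈⟨ ∙-cong (sum-cong-≋ (λ x → if-sum (lookup l x) (on-line x))) (sym (sumOn-⁅⁆ p v)) ⟩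
    sum (λ x → sum (λ y → if lookup l x then on-line x y else ε)) ∙ sumOn ⁅ p ⁆ v
      ≈⟨ ∙-congʳ (∑-comm (λ x y → if lookup l x then on-line x y else ε)) ⟩
    sum column ∙ sumOn ⁅ p ⁆ v
      ≈⟨ ∑-distrib-+ column (at-p v) ⟨
    sum (λ y → column y ∙ at-p v y)
      ≈⟨ sum-cong-≋ column-balanced ⟩
    sum (λ y → at-p (λ z → ∣ l ∣ × v z) y ∙ v y)
      ≈⟨ ∑-distrib-+ (at-p (λ z → ∣ l ∣ × v z)) v ⟩
    sumOn ⁅ p ⁆ (λ y → ∣ l ∣ × v y) ∙ sum v
      ≈⟨ ∙-congʳ (sumOn-⁅⁆ p (λ y → ∣ l ∣ × v y)) ⟩
    ∣ l ∣ × v p ∙ sum v ∎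
    where
    on-line : Fin n → Fin n → Carrier
    on-line x y = if lookup (L x) y then v y else ε
    at-p : (Fin n → Carrier) → Fin n → Carrier
    at-p f y = if lookup ⁅ p ⁆ y then f y else ε

module TorsionFreeCancellation {c ℓ : Level} (G : AbelianGroup c ℓ)
  (torsion-free : TorsionFree G) where
  open AbelianGroup G
  open SubsetSums commutativeMonoid using (_×_)
  open import Algebra.Properties.CommutativeMonoid.Mult commutativeMonoid
    using (×-distrib-+; ×-congʳ)
  open import Algebra.Properties.Group group using (∙-cancelʳ; x∙y⁻¹≈ε⇒x≈y)
  open import Algebra.Solver.CommutativeMonoid commutativeMonoid using (solve; _⊜_; _⊕_)
  open import Relation.Binary.Reasoning.Setoid setoid

  ·≡× : ∀ k x → _·_ G k x ≡ k × x
  ·≡× zero    x = ≡.refl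
  ·≡× (suc k) x = ≡.cong (x ∙_) (·≡× k x)

  ×-annihilates : ∀ j x → suc j × x ≈ ε → x ≈ ε
  ×-annihilates j x jx≈ε with torsion-free (suc j) x (trans (reflexive (·≡× (suc j) x)) jx≈ε)
  ... | inj₁ ()
  ... | inj₂ x≈ε = x≈ε

  ×-cancel : ∀ j {a b} → suc j × a ≈ suc j × b → a ≈ b
  ×-cancel j {a} {b} ja≈jb = x∙y⁻¹≈ε⇒x≈y a b (×-annihilates j (a ∙ b ⁻¹) multiple≈ε)
    where
    multiple≈ε : suc j × (a ∙ b ⁻¹) ≈ ε
    multiple≈ε = ∙-cancelʳ (suc j × b) _ _ (begin
      suc j × (a ∙ b ⁻¹) ∙ suc j × b  ≈⟨ ×-distrib-+ (a ∙ b ⁻¹) b (suc j) ⟨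
      suc j × (a ∙ b ⁻¹ ∙ b)          ≈⟨ ×-congʳ (suc j) (trans (assoc a (b ⁻¹) b)
                                           (trans (∙-congˡ (inverseˡ b)) (identityʳ a))) ⟩
      suc j × a                       ≈⟨ ja≈jb ⟩
      suc j × b                       ≈⟨ identityˡ _ ⟨
      ε ∙ suc j × b                   ∎)

  -- The pencil identity  k·c + a = k·a + s  determines (k-1)·a = k·c - s;
  -- so when k ≥ 2 it determines a itself.
  pencil-identity-unique : ∀ {k} → 2 ≤ k → ∀ {c s a b} →
    k × c ∙ a ≈ k × a ∙ s → k × c ∙ b ≈ k × b ∙ s → a ≈ b
  pencil-identity-unique {suc (suc i)} (s≤s (s≤s _)) {c} {s} {a} {b} for-a for-b =
    ×-cancel i (∙-cancelʳ s _ _ (trans (sym (isolate for-a)) (isolate for-b)))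
    where
    isolate : ∀ {x} → suc (suc i) × c ∙ x ≈ suc (suc i) × x ∙ s → suc (suc i) × c ≈ suc i × x ∙ s
    isolate {x} eq = ∙-cancelʳ x _ _ (trans eq
      (solve 3 (λ x jx s → (x ⊕ jx) ⊕ s ⊜ (jx ⊕ s) ⊕ x) refl x (suc i × x) s))

module Incidence {n m : ℕ} {line : Fin m → Subset n} (plane : IsProjectivePlane line) where
  open IsProjectivePlane plane

  join : (p q : Fin n) → p ≢ q → Fin m
  join p q p≢q = proj₁ (two-points p q p≢q)

  join-∋ˡ : ∀ {p q} (p≢q : p ≢ q) → p ∈ line (join p q p≢q)
  join-∋ˡ {p} {q} p≢q = proj₁ (proj₂ (two-points p q p≢q))

  join-∋ʳ : ∀ {p q} (p≢q : p ≢ q) → q ∈ line (join p q p≢q)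
  join-∋ʳ {p} {q} p≢q = proj₁ (proj₂ (proj₂ (two-points p q p≢q)))

  join-unique : ∀ {p q l} (p≢q : p ≢ q) → p ∈ line l → q ∈ line l → l ≡ join p q p≢q
  join-unique {p} {q} {l} p≢q = proj₂ (proj₂ (proj₂ (two-points p q p≢q))) l

  meet : (l l' : Fin m) → l ≢ l' → Fin n
  meet l l' l≢l' = proj₁ (two-lines l l' l≢l')

  meet-∈ˡ : ∀ {l l'} (l≢l' : l ≢ l') → meet l l' l≢l' ∈ line l
  meet-∈ˡ {l} {l'} l≢l' = proj₁ (proj₂ (two-lines l l' l≢l'))

  meet-∈ʳ : ∀ {l l'} (l≢l' : l ≢ l') → meet l l' l≢l' ∈ line l'
  meet-∈ʳ {l} {l'} l≢l' = proj₁ (proj₂ (proj₂ (two-lines l l' l≢l')))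

  meet-unique : ∀ {l l' x} (l≢l' : l ≢ l') → x ∈ line l → x ∈ line l' → x ≡ meet l l' l≢l'
  meet-unique {l} {l'} {x} l≢l' = proj₂ (proj₂ (proj₂ (two-lines l l' l≢l'))) x

  common-point-unique : ∀ {l l' x y} → l ≢ l' →
    x ∈ line l → x ∈ line l' → y ∈ line l → y ∈ line l' → x ≡ y
  common-point-unique l≢l' x∈l x∈l' y∈l y∈l' =
    ≡.trans (meet-unique l≢l' x∈l x∈l') (≡.sym (meet-unique l≢l' y∈l y∈l'))

  separated : ∀ {p l l'} → p ∈ line l → p ∉ line l' → l ≢ l'
  separated p∈l p∉l' ≡.refl = p∉l' p∈l

  -- The pencil of lines joining a point p off the line l to the points of l
  -- satisfies the hypotheses of the double-counting lemma.
  module PencilAt (l : Fin m) {p : Fin n} (p∉l : p ∉ line l) where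

    -- The line through p and x (the value at x = p is irrelevant).
    ray : Fin n → Fin m
    ray x with p ≟ x
    ... | yes _    = l
    ... | no  p≢x = join p x p≢x

    ray-∋p : ∀ {x} → p ≢ x → p ∈ line (ray x)
    ray-∋p {x} p≢x with p ≟ x
    ... | yes p≡x  = contradiction p≡x p≢x
    ... | no  p≢x′ = join-∋ˡ p≢x′

    ray-∋x : ∀ {x} → p ≢ x → x ∈ line (ray x)
    ray-∋x {x} p≢x with p ≟ x
    ... | yes p≡x  = contradiction p≡x p≢x
    ... | no  p≢x′ = join-∋ʳ p≢x′

    ray-unique : ∀ {x l'} → p ≢ x → p ∈ line l' → x ∈ line l' → l' ≡ ray x
    ray-unique {x} p≢x with p ≟ x
    ... | yes p≡x  = contradiction p≡x p≢x
    ... | no  p≢x′ = join-unique p≢x′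

    off-l : ∀ {x} → x ∈ line l → p ≢ x
    off-l x∈l ≡.refl = p∉l x∈l

    through : ∀ {x} → x ∈ line l → p ∈ line (ray x)
    through x∈l = ray-∋p (off-l x∈l)

    base : ∀ {y} → y ≢ p → Fin n
    base {y} y≢p = meet l (ray y) (≢-sym (separated (ray-∋p (≢-sym y≢p)) p∉l))

    base-∈ : ∀ {y} (y≢p : y ≢ p) → base y≢p ∈ line l
    base-∈ y≢p = meet-∈ˡ _

    base-covers : ∀ {y} (y≢p : y ≢ p) → y ∈ line (ray (base y≢p))
    base-covers {y} y≢p = ≡.subst (λ l' → y ∈ line l') same-ray (ray-∋x (≢-sym y≢p))
      where
      same-ray : ray y ≡ ray (base y≢p)
      same-ray = ray-unique (off-l (base-∈ y≢p)) (ray-∋p (≢-sym y≢p)) (meet-∈ʳ _)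

    base-unique : ∀ {x y} (y≢p : y ≢ p) → x ∈ line l → y ∈ line (ray x) → x ≡ base y≢p
    base-unique {x} {y} y≢p x∈l y∈rx = meet-unique _ x∈l x∈ry
      where
      x∈ry : x ∈ line (ray y)
      x∈ry = ≡.subst (λ l' → x ∈ line l')
               (ray-unique (≢-sym y≢p) (through x∈l) y∈rx) (ray-∋x (off-l x∈l))

  -- A quadrangle a₀a₁a₂a₃ provides the lines
  -- A = a₀a₁, B = a₂a₃, C = a₀a₂, D = a₁a₃; every point is linked through
  -- them to the point e = C ∩ D, which lies on neither A nor B.
  module _ {s r : Level} (S : Setoid s r) (f : Fin n → Setoid.Carrier S) where
    open Setoid S
    open import Data.Fin.Patterns using (0F; 1F; 2F; 3F)

    constant-off-lines⇒constant :
      (∀ {l x y p q} → x ∈ line l → y ∈ line l → x ≢ y → p ∉ line l → q ∉ line l → f p ≈ f q) →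
      ∀ x y → f x ≈ f y
    constant-off-lines⇒constant constant-off x y = trans (to-e x) (sym (to-e y))
      where
      a : Fin 4 → Fin n
      a = proj₁ quadrangle

      distinct : ∀ {i j} → i ≢ j → a i ≢ a j
      distinct i≢j a≡ = i≢j (proj₁ (proj₂ quadrangle) a≡)

      not-collinear : ∀ i j k → i ≢ j → j ≢ k → i ≢ k → ∀ {l} →
        a i ∈ line l → a j ∈ line l → a k ∈ line l → ⊥
      not-collinear i j k i≢j j≢k i≢k {l} ai aj ak =
        proj₂ (proj₂ quadrangle) i j k i≢j j≢k i≢k (l , ai , aj , ak)

      A B C D : Fin m
      A = join (a 0F) (a 1F) (distinct (λ ()))
      B = join (a 2F) (a 3F) (distinct (λ ()))
      C = join (a 0F) (a 2F) (distinct (λ ()))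
      D = join (a 1F) (a 3F) (distinct (λ ()))

      C≢D : C ≢ D
      C≢D C≡D = not-collinear 0F 1F 3F (λ ()) (λ ()) (λ ())
        (≡.subst (λ l → a 0F ∈ line l) C≡D (join-∋ˡ _)) (join-∋ˡ _) (join-∋ʳ _)

      A≢C : A ≢ C
      A≢C A≡C = not-collinear 0F 1F 2F (λ ()) (λ ()) (λ ())
        (join-∋ˡ _) (join-∋ʳ _) (≡.subst (λ l → a 2F ∈ line l) (≡.sym A≡C) (join-∋ʳ _))

      B≢C : B ≢ C
      B≢C B≡C = not-collinear 0F 2F 3F (λ ()) (λ ()) (λ ())
        (≡.subst (λ l → a 0F ∈ line l) (≡.sym B≡C) (join-∋ˡ _)) (join-∋ˡ _) (join-∋ʳ _)

      e : Fin n
      e = meet C D C≢D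

      e∉A : e ∉ line A
      e∉A e∈A = not-collinear 0F 1F 3F (λ ()) (λ ()) (λ ())
        (≡.subst (λ z → z ∈ line D) e≡a₀ (meet-∈ʳ C≢D)) (join-∋ˡ _) (join-∋ʳ _)
        where
        e≡a₀ : e ≡ a 0F
        e≡a₀ = common-point-unique A≢C e∈A (meet-∈ˡ C≢D) (join-∋ˡ _) (join-∋ˡ _)

      e∉B : e ∉ line B
      e∉B e∈B = not-collinear 1F 2F 3F (λ ()) (λ ()) (λ ())
        (join-∋ˡ _) (≡.subst (λ z → z ∈ line D) e≡a₂ (meet-∈ʳ C≢D)) (join-∋ʳ _)
        where
        e≡a₂ : e ≡ a 2F
        e≡a₂ = common-point-unique B≢C e∈B (meet-∈ˡ C≢D) (join-∋ˡ _) (join-∋ʳ _)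

      a₁∉B : a 1F ∉ line B
      a₁∉B a₁∈B = not-collinear 1F 2F 3F (λ ()) (λ ()) (λ ()) a₁∈B (join-∋ˡ _) (join-∋ʳ _)

      a₁∉C : a 1F ∉ line C
      a₁∉C a₁∈C = not-collinear 0F 1F 2F (λ ()) (λ ()) (λ ()) (join-∋ˡ _) a₁∈C (join-∋ʳ _)

      -- The only point of A on C is a₀, which is not on B.
      off-C : ∀ {z} → z ∈ line A → z ∈ line B → z ∉ line C
      off-C z∈A z∈B z∈C = not-collinear 0F 2F 3F (λ ()) (λ ()) (λ ())
        (≡.subst (λ w → w ∈ line B) z≡a₀ z∈B) (join-∋ˡ _) (join-∋ʳ _)
        where
        z≡a₀ : _ ≡ a 0F
        z≡a₀ = common-point-unique A≢C z∈A z∈C (join-∋ˡ _) (join-∋ˡ _)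

      to-e : ∀ z → f z ≈ f e
      to-e z with z ∈? line A | z ∈? line B
      ... | no z∉A | _      = constant-off (join-∋ˡ _) (join-∋ʳ _) (distinct (λ ())) z∉A e∉A
      ... | yes _  | no z∉B = constant-off (join-∋ˡ _) (join-∋ʳ _) (distinct (λ ())) z∉B e∉B
      ... | yes z∈A | yes z∈B = trans
        (constant-off (join-∋ˡ _) (join-∋ʳ _) (distinct (λ ())) (off-C z∈A z∈B) a₁∉C)
        (constant-off (join-∋ˡ _) (join-∋ʳ _) (distinct (λ ())) a₁∉B e∉B)

module LineInvariantValues {c ℓ : Level} (G : AbelianGroup c ℓ) (torsion-free : TorsionFree G)
  {n m : ℕ} {line : Fin m → Subset n} (plane : IsProjectivePlane line)
  (v : Fin n → AbelianGroup.Carrier G) (invariant : LineInvariant G line v) where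
  open AbelianGroup G
  open SubsetSums commutativeMonoid
  open TorsionFreeCancellation G torsion-free using (pencil-identity-unique)
  open Incidence plane
  open import Relation.Binary.Reasoning.Setoid setoid

  sumOver≡sumOn : ∀ {k} (S : Subset k) (w : Fin k → Carrier) → sumOver G S w ≡ sumOn S w
  sumOver≡sumOn []          w = ≡.refl
  sumOver≡sumOn (true  ∷ S) w = ≡.cong (w zero ∙_) (sumOver≡sumOn S (λ x → w (suc x)))
  sumOver≡sumOn (false ∷ S) w = ≡.cong (ε ∙_) (sumOver≡sumOn S (λ x → w (suc x)))

  line-sum : Fin m → Carrier
  line-sum l = sumOn (line l) v

  line-sum-invariant : ∀ l l' → line-sum l ≈ line-sum l'
  line-sum-invariant l l' = begin
    line-sum l               ≡⟨ sumOver≡sumOn (line l) v ⟨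
    sumOver G (line l) v     ≈⟨ invariant l l' ⟩
    sumOver G (line l') v    ≡⟨ sumOver≡sumOn (line l') v ⟩
    line-sum l'              ∎

  off-line-identity : ∀ l {p} → p ∉ line l →
    ∣ line l ∣ × line-sum l ∙ v p ≈ ∣ line l ∣ × v p ∙ sum v
  off-line-identity l {p} p∉l = begin
    ∣ line l ∣ × line-sum l ∙ v p
      ≈⟨ ∙-congʳ (sumOn-const (line l) (line-sum l)) ⟨
    sumOn (line l) (λ _ → line-sum l) ∙ v p
      ≈⟨ ∙-congʳ (sumOn-cong (line l) (λ {x} _ → line-sum-invariant l (ray x))) ⟩
    sumOn (line l) (λ x → line-sum (ray x)) ∙ v p
      ≈⟨ pencil-sum ⟩
    ∣ line l ∣ × v p ∙ sum v ∎
    where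
    open PencilAt l p∉l
    open Pencil commutativeMonoid v (line l) p (λ x → line (ray x))
      through base base-∈ base-covers base-unique

  constant-off-line : ∀ {l x y p q} → x ∈ line l → y ∈ line l → x ≢ y →
    p ∉ line l → q ∉ line l → v p ≈ v q
  constant-off-line {l} x∈l y∈l x≢y p∉l q∉l =
    pencil-identity-unique (two-members x∈l y∈l x≢y)
      (off-line-identity l p∉l) (off-line-identity l q∉l)

theorem2 : ∀ {c ℓ : Level} (G : AbelianGroup c ℓ) → TorsionFree G →
    ∀ (n m : ℕ) (line : Fin m → Subset n) → IsProjectivePlane line →
    ∀ (v : Fin n → AbelianGroup.Carrier G) → LineInvariant G line v → Constant G v
theorem2 G torsion-free n m line plane v invariant =
  constant-off-lines⇒constant (AbelianGroup.setoid G) v constant-off-line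
  where
  open Incidence plane using (constant-off-lines⇒constant)
  open LineInvariantValues G torsion-free plane v invariant using (constant-off-line)
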